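{- For each integer $j\ge 5$, there exists a minimal covering system whose moduli are exactly the following $j$ distinct integers (listed in increasing order): \[ 2<2^2<2^3<\dots<2^{j-4}<3\cdot 2^{j-5}<2^{j-3}<3\cdot 2^{j-4}<3\cdot 2^{j-3}. \]
   Context: A covering system is a finite set of arithmetic progressions (congruence classes $r \bmod q$) whose union is $\mathbb{Z}$. A covering system is minimal if no proper subset of its arithmetic progressions covers $\mathbb{Z}$. -}

module Defs where

open import Data.Nat using (ℕ; suc; _*_; _^_; _∸_; _<_)
open import Data.Integer using (ℤ; +_; _-_)
open import Data.Integer.Divisibility using (_∣_)
open import Data.List using (List; []; _∷_; _++_; map; length; upTo)
open import Data.List.Membership.Propositional using (_∈_)
open import Data.List.Relation.Binary.Sublist.Propositional using (_⊆_)
open import Data.Product using (_×_; Σ; ∃-syntax; _,_; proj₂)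
open import Relation.Nullary using (¬_)

-- An arithmetic progression r mod q, with r ∈ ℤ and modulus q ∈ ℕ.
AP : Set
AP = ℤ × ℕ

_∈AP_ : ℤ → AP → Set
n ∈AP (r , q) = (+ q) ∣ (n - r)

Covers : List AP → Set
Covers S = ∀ (n : ℤ) → ∃[ a ] (a ∈ S × n ∈AP a)

MinimalCovering : List AP → Set
MinimalCovering S =
  Covers S × (∀ (T : List AP) → T ⊆ S → length T < length S → ¬ Covers T)

moduli : List AP → List ℕ
moduli S = map proj₂ S

-- For j ≥ 5 (in increasing order):
-- 2, 2^2, ..., 2^(j-4), 3·2^(j-5), 2^(j-3), 3·2^(j-4), 3·2^(j-3)
-- (upTo (j ∸ 4) = 0 … j-5, so the first block is 2^1 … 2^(j-4))
targetModuli : ℕ → List ℕ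
targetModuli j =
  map (λ i → 2 ^ suc i) (upTo (j ∸ 4))
  ++ (3 * 2 ^ (j ∸ 5)) ∷ (2 ^ (j ∸ 3)) ∷ (3 * 2 ^ (j ∸ 4)) ∷ (3 * 2 ^ (j ∸ 3)) ∷ []

-- The system 1 mod 2, 1 mod 3, 0 mod 4, 2 mod 6, 6 mod 12 is a minimal covering
-- with moduli 2, 3, 4, 6, 12 (the case j = 5). Given a minimal covering S, the
-- family consisting of 1 mod 2 and the progressions 2r mod 2q for (r mod q) ∈ S
-- is again a minimal covering: the odd integers are covered only by 1 mod 2, and
-- on the even integers 2m the doubled progressions behave exactly as S does on m.
-- Its moduli are 2 followed by the doubled moduli of S, which is how the target
-- list for j + 1 arises from the one for j.
module Submission where

open import Defs
open import Data.Nat using (ℕ; _≤_)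
open import Data.List using (List)
open import Data.Product using (_×_; ∃-syntax)
open import Relation.Binary.PropositionalEquality using (_≡_)

open import Data.Nat as ℕ using (zero; suc; NonZero)
import Data.Nat.Properties as ℕ
import Data.Nat.Divisibility as ℕ
open import Data.Integer as ℤ using (ℤ; +_; _-_)
import Data.Integer.Properties as ℤ
import Data.Integer.Divisibility as ℤ
import Data.Integer.Divisibility.Signed as ℤˢ
open import Data.Integer.DivMod using (_%ℕ_; _/ℕ_; a≡a%ℕn+[a/ℕn]*n; n%ℕd<d)
open import Data.Integer.Tactic.RingSolver using (solve-∀)
open import Data.Vec as Vec using (_∷_; [])
open import Data.Fin as Fin using (Fin; toℕ; fromℕ<)
import Data.Fin.Properties as Fin
open import Data.List using ([]; _∷_; _++_; map; length; upTo; applyUpTo; removeAt)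
open import Data.List.Properties using (length-map; map-∘; map-++; map-upTo; map-applyUpTo)
open import Data.List.Membership.Propositional using (_∈_; find)
open import Data.List.Membership.Propositional.Properties using (∈-map⁺; ∈-map⁻)
open import Data.List.Relation.Unary.Any using (Any; any?; here; there)
open import Data.List.Relation.Unary.All as All using (All; all?)
open import Data.List.Relation.Binary.Sublist.Propositional using (_⊆_; []; _∷ʳ_; _∷_)
open import Data.List.Relation.Binary.Sublist.Propositional.Properties using (All-resp-⊆)
open import Data.Product using (_,_; proj₂)
open import Data.Sum using (_⊎_; inj₁; inj₂)
open import Data.Empty using (⊥-elim)
open import Function using (_∘_)
open import Relation.Nullary using (¬_; ¬?)
open import Relation.Nullary.Decidable using (from-yes)
open import Relation.Binary using (Decidable)
open import Relation.Binary.PropositionalEquality using (refl; sym; trans; cong; cong₂; subst; subst₂; module ≡-Reasoning)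
open ≡-Reasoning

_∈AP?_ : Decidable _∈AP_
n ∈AP? (r , q) = q ℕ.∣? ℤ.∣ n - r ∣

Uncovered : ℤ → List AP → Set
Uncovered n = All (λ a → ¬ (n ∈AP a))

uncovered⇒¬Covers : ∀ {T S} n → T ⊆ S → Uncovered n S → ¬ Covers T
uncovered⇒¬Covers n τ n∉S cover =
  let a , a∈T , n∈a = cover n in All.lookup (All-resp-⊆ τ n∉S) a∈T n∈a

⊂⇒⊆-removeAt : ∀ {A : Set} {T S : List A} → T ⊆ S → length T ℕ.< length S →
               ∃[ i ] (T ⊆ removeAt S i)
⊂⇒⊆-removeAt (y ∷ʳ τ) _ = Fin.zero , τ
⊂⇒⊆-removeAt (x≡y ∷ τ) (ℕ.s≤s |T|<|S|) with ⊂⇒⊆-removeAt τ |T|<|S|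
... | i , τ′ = Fin.suc i , x≡y ∷ τ′

minimal-if-uniquely-covered : ∀ S → Covers S →
  (∀ i → ∃[ n ] Uncovered n (removeAt S i)) → MinimalCovering S
minimal-if-uniquely-covered S cover unique = cover , irredundant
  where
  irredundant : ∀ T → T ⊆ S → length T ℕ.< length S → ¬ Covers T
  irredundant T τ |T|<|S| with ⊂⇒⊆-removeAt τ |T|<|S|
  ... | i , τ′ = let n , n∉S-i = unique i in uncovered⇒¬Covers n τ′ n∉S-i

∈AP-periodic : ∀ n t {r q N} → q ℕ.∣ N → n ∈AP (r , q) → (n ℤ.+ t ℤ.* + N) ∈AP (r , q)
∈AP-periodic n t {r} {q} {N} q∣N n∈a =
  ℤˢ.∣⇒∣ᵤ (subst (+ q ℤˢ.∣_) (shift n (t ℤ.* + N) r) q∣n-r+tN)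
  where
  shift : ∀ a b c → (a - c) ℤ.+ b ≡ (a ℤ.+ b) - c
  shift = solve-∀
  q∣n-r+tN : + q ℤˢ.∣ (n - r) ℤ.+ t ℤ.* + N
  q∣n-r+tN = ℤˢ.∣m∣n⇒∣m+n {m = n - r} (ℤˢ.∣ᵤ⇒∣ n∈a) (ℤˢ.∣n⇒∣m*n t (ℤˢ.∣ᵤ⇒∣ q∣N))

covers-if-residues-covered : ∀ S N .{{_ : NonZero N}} → All (λ a → proj₂ a ℕ.∣ N) S →
  (∀ (c : Fin N) → Any (_∈AP_ (+ toℕ c)) S) → Covers S
covers-if-residues-covered S N moduli∣N residues n =
  let a , a∈S , c∈a = find (residues c) in
  a , a∈S , subst (_∈AP a) (sym n≡c+tN) (∈AP-periodic (+ toℕ c) (n /ℕ N) (All.lookup moduli∣N a∈S) c∈a)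
  where
  c : Fin N
  c = fromℕ< (n%ℕd<d n N)
  n≡c+tN : n ≡ + toℕ c ℤ.+ (n /ℕ N) ℤ.* + N
  n≡c+tN = trans (a≡a%ℕn+[a/ℕn]*n n N)
    (cong (λ r → + r ℤ.+ (n /ℕ N) ℤ.* + N) (sym (Fin.toℕ-fromℕ< (n%ℕd<d n N))))

base : List AP
base = (+ 1 , 2) ∷ (+ 1 , 3) ∷ (+ 0 , 4) ∷ (+ 2 , 6) ∷ (+ 6 , 12) ∷ []

base-covers : Covers base
base-covers = covers-if-residues-covered base 12
  (from-yes (all? (λ a → proj₂ a ℕ.∣? 12) base))
  (from-yes (Fin.all? {12} λ c → any? (_∈AP?_ (+ toℕ c)) base))

-- The i-th progression of base is the only one containing witness i.
base-minimal : MinimalCovering base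
base-minimal = minimal-if-uniquely-covered base base-covers λ i → witness i ,
  from-yes (Fin.all? {5} (λ i → all? (λ a → ¬? (witness i ∈AP? a)) (removeAt base i))) i
  where
  witness : Fin 5 → ℤ
  witness = Vec.lookup (+ 3 ∷ + 10 ∷ + 0 ∷ + 2 ∷ + 6 ∷ [])

double : AP → AP
double (r , q) = (+ 2 ℤ.* r , 2 ℕ.* q)

2[m-r]≡2m-2r : ∀ m r → + 2 ℤ.* (m - r) ≡ + 2 ℤ.* m - + 2 ℤ.* r
2[m-r]≡2m-2r = solve-∀

∈AP-double⁺ : ∀ m a → m ∈AP a → (+ 2 ℤ.* m) ∈AP double a
∈AP-double⁺ m (r , q) m∈a =
  subst₂ ℤ._∣_ (sym (ℤ.pos-* 2 q)) (2[m-r]≡2m-2r m r) (ℤ.*-monoʳ-∣ (+ 2) {+ q} {m - r} m∈a)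

∈AP-double⁻ : ∀ m a → (+ 2 ℤ.* m) ∈AP double a → m ∈AP a
∈AP-double⁻ m (r , q) 2m∈a =
  ℤ.*-cancelˡ-∣ (+ 2) {+ q} {m - r} (subst₂ ℤ._∣_ (ℤ.pos-* 2 q) (sym (2[m-r]≡2m-2r m r)) 2m∈a)

2∤1 : ¬ (2 ℕ.∣ 1)
2∤1 2∣1 with () ← ℕ.∣1⇒≡1 2∣1

1∉double : ∀ a → ¬ ((+ 1) ∈AP double a)
1∉double (r , q) 1∈2a = 2∤1 (ℤˢ.∣⇒∣ᵤ (ℤˢ.∣m+n∣n⇒∣m {m = + 1} 2∣1-2r 2∣-2r))
  where
  2∣1-2r : + 2 ℤˢ.∣ + 1 - + 2 ℤ.* r
  2∣1-2r = ℤˢ.∣ᵤ⇒∣ (ℕ.∣-trans (ℕ.m∣m*n q) 1∈2a)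
  2∣-2r : + 2 ℤˢ.∣ ℤ.- (+ 2 ℤ.* r)
  2∣-2r = ℤˢ.∣m⇒∣-m (ℤˢ.∣m⇒∣m*n r ℤˢ.∣-refl)

even∉odds : ∀ m → ¬ ((+ 2 ℤ.* m) ∈AP (+ 1 , 2))
even∉odds m 2m∈odds =
  2∤1 (ℤˢ.∣⇒∣ᵤ (ℤˢ.∣m+n∣m⇒∣n {+ 2} {n = ℤ.- + 1} (ℤˢ.∣ᵤ⇒∣ 2m∈odds) (ℤˢ.∣m⇒∣m*n m ℤˢ.∣-refl)))

even-or-odd : ∀ n → (∃[ m ] n ≡ + 2 ℤ.* m) ⊎ n ∈AP (+ 1 , 2)
even-or-odd n with n %ℕ 2 | a≡a%ℕn+[a/ℕn]*n n 2 | n%ℕd<d n 2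
... | 0 | n≡2t | _ = inj₁ (n /ℕ 2 , trans n≡2t (even (n /ℕ 2)))
  where
  even : ∀ t → + 0 ℤ.+ t ℤ.* + 2 ≡ + 2 ℤ.* t
  even = solve-∀
... | 1 | n≡1+2t | _ = inj₂ (ℤˢ.∣⇒∣ᵤ (ℤˢ.divides (n /ℕ 2) (trans (cong (_- + 1) n≡1+2t) (odd (n /ℕ 2)))))
  where
  odd : ∀ t → (+ 1 ℤ.+ t ℤ.* + 2) - + 1 ≡ t ℤ.* + 2
  odd = solve-∀
... | suc (suc _) | _ | ℕ.s≤s (ℕ.s≤s ())

lift : List AP → List AP
lift S = (+ 1 , 2) ∷ map double S

lift-covers : ∀ {S} → Covers S → Covers (lift S)
lift-covers cover n with even-or-odd n
... | inj₂ n∈odds = _ , here refl , n∈odds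
... | inj₁ (m , refl) with cover m
...   | a , a∈S , m∈a = double a , there (∈-map⁺ double a∈S) , ∈AP-double⁺ m a m∈a

lift-covers⁻ : ∀ {S} → Covers (lift S) → Covers S
lift-covers⁻ cover m with cover (+ 2 ℤ.* m)
... | _ , here refl , 2m∈odds = ⊥-elim (even∉odds m 2m∈odds)
... | _ , there a∈2S , 2m∈a with ∈-map⁻ double a∈2S
...   | a , a∈S , refl = a , a∈S , ∈AP-double⁻ m a 2m∈a

map-double-¬covers : ∀ S → ¬ Covers (map double S)
map-double-¬covers S cover with cover (+ 1)
... | _ , a∈2S , 1∈a with ∈-map⁻ double a∈2S
...   | a , _ , refl = 1∉double a 1∈a

⊆-map⁻¹ : ∀ {A B : Set} (f : A → B) {T} L → T ⊆ map f L → ∃[ U ] (U ⊆ L × T ≡ map f U)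
⊆-map⁻¹ f [] [] = [] , [] , refl
⊆-map⁻¹ f (x ∷ L) (_ ∷ʳ τ) with ⊆-map⁻¹ f L τ
... | U , U⊆L , refl = U , x ∷ʳ U⊆L , refl
⊆-map⁻¹ f (x ∷ L) (refl ∷ τ) with ⊆-map⁻¹ f L τ
... | U , U⊆L , refl = x ∷ U , refl ∷ U⊆L , refl

lift-minimal : ∀ {S} → MinimalCovering S → MinimalCovering (lift S)
lift-minimal {S} (cover , irredundant) = lift-covers cover , irredundant′
  where
  irredundant′ : ∀ T → T ⊆ lift S → length T ℕ.< length (lift S) → ¬ Covers T
  irredundant′ _ (_ ∷ʳ τ) _ with ⊆-map⁻¹ double S τ
  ... | U , _ , refl = map-double-¬covers U
  irredundant′ (_ ∷ T) (refl ∷ τ) (ℕ.s≤s |T|<|2S|) with ⊆-map⁻¹ double S τ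
  ... | U , U⊆S , refl = irredundant U U⊆S |U|<|S| ∘ lift-covers⁻
    where
    |U|<|S| : length U ℕ.< length S
    |U|<|S| = subst₂ ℕ._<_ (length-map double U) (length-map double S) |T|<|2S|

moduli-lift : ∀ S → moduli (lift S) ≡ 2 ∷ map (2 ℕ.*_) (moduli S)
moduli-lift S = cong (2 ∷_) (trans (sym (map-∘ S)) (map-∘ S))

targetModuli-suc : ∀ k → targetModuli (6 ℕ.+ k) ≡ 2 ∷ map (2 ℕ.*_) (targetModuli (5 ℕ.+ k))
targetModuli-suc k = cong (2 ∷_) (begin
  map pow (applyUpTo suc (suc k)) ++ last (suc k)
    ≡⟨ cong (map pow (applyUpTo suc (suc k)) ++_) (last-suc k) ⟩
  map pow (applyUpTo suc (suc k)) ++ map (2 ℕ.*_) (last k)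
    ≡⟨ cong (_++ map (2 ℕ.*_) (last k)) (map-applyUpTo suc pow (suc k)) ⟩
  applyUpTo (pow ∘ suc) (suc k) ++ map (2 ℕ.*_) (last k)
    ≡⟨ cong (_++ map (2 ℕ.*_) (last k)) (sym (map-upTo (pow ∘ suc) (suc k))) ⟩
  map (pow ∘ suc) (upTo (suc k)) ++ map (2 ℕ.*_) (last k)
    ≡⟨ cong (_++ map (2 ℕ.*_) (last k)) (map-∘ (upTo (suc k))) ⟩
  map (2 ℕ.*_) (map pow (upTo (suc k))) ++ map (2 ℕ.*_) (last k)
    ≡⟨ map-++ (2 ℕ.*_) (map pow (upTo (suc k))) (last k) ⟨
  map (2 ℕ.*_) (map pow (upTo (suc k)) ++ last k) ∎)
  where
  pow : ℕ → ℕ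
  pow i = 2 ℕ.^ suc i
  last : ℕ → List ℕ
  last k = 3 ℕ.* 2 ℕ.^ k ∷ 2 ℕ.^ (2 ℕ.+ k) ∷ 3 ℕ.* 2 ℕ.^ (1 ℕ.+ k) ∷ 3 ℕ.* 2 ℕ.^ (2 ℕ.+ k) ∷ []
  3*2x≡2*3x : ∀ x → 3 ℕ.* (2 ℕ.* x) ≡ 2 ℕ.* (3 ℕ.* x)
  3*2x≡2*3x x = trans (sym (ℕ.*-assoc 3 2 x)) (ℕ.*-assoc 2 3 x)
  last-suc : ∀ k → last (suc k) ≡ map (2 ℕ.*_) (last k)
  last-suc k = cong₂ _∷_ (3*2x≡2*3x (2 ℕ.^ k)) (cong (2 ℕ.^ (3 ℕ.+ k) ∷_)
    (cong₂ _∷_ (3*2x≡2*3x (2 ℕ.^ (1 ℕ.+ k))) (cong₂ _∷_ (3*2x≡2*3x (2 ℕ.^ (2 ℕ.+ k))) refl)))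

system : ℕ → List AP
system zero = base
system (suc k) = lift (system k)

system-minimal : ∀ k → MinimalCovering (system k)
system-minimal zero = base-minimal
system-minimal (suc k) = lift-minimal (system-minimal k)

moduli-system : ∀ k → moduli (system k) ≡ targetModuli (5 ℕ.+ k)
moduli-system zero = refl
moduli-system (suc k) = begin
  moduli (lift (system k))                   ≡⟨ moduli-lift (system k) ⟩
  2 ∷ map (2 ℕ.*_) (moduli (system k))      ≡⟨ cong (λ ms → 2 ∷ map (2 ℕ.*_) ms) (moduli-system k) ⟩
  2 ∷ map (2 ℕ.*_) (targetModuli (5 ℕ.+ k)) ≡⟨ targetModuli-suc k ⟨
  targetModuli (6 ℕ.+ k)                     ∎

theorem2 : ∀ (j : ℕ) → 5 ≤ j → ∃[ S ] (MinimalCovering S × moduli S ≡ targetModuli j)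
theorem2 j 5≤j with ℕ.m≤n⇒∃[o]m+o≡n 5≤j
... | k , refl = system k , system-minimal k , moduli-system k
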